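{- Let $\mathcal{C}$ be a category with cofibrations and an interval satisfying the general conditions (G1)–(G7) below. Suppose $m_0\colon A_0\to B$ and $m_1\colon A_1\to B$ are monomorphisms, at least one of which is a cofibration, $f\colon X\to B$ is an hproposition, and $t_0\colon A_0\to X$, $t_1\colon A_1\to X$ satisfy $f\circ t_0=m_0$ and $f\circ t_1=m_1$. Let $m\colon A_0\cup A_1\to B$ be the union of the subobjects $m_0,m_1$. Then there is a map $t\colon A_0\cup A_1\to X$ with $f\circ t=m$.
   Context: $\mathcal{C}$ is locally cartesian closed with finite colimits, with cofibrations and an interval $\delta_0,\delta_1\colon1\to\mathbb{I}$. Trivial fibrations: maps with the right lifting property (RLP) against all cofibrations; fibrations: maps with the RLP against $\delta_0\hat\times m$, $\delta_1\hat\times m$ for cofibrations $m$ ($\hat\times$ the pushout product). (G1) cofibrations closed under pullback; (G2) closed under binary unions; (G3) $\mathbb{I}$ has connections $\wedge,\vee$ with $0\wedge i=i\wedge0=0$, $1\wedge i=i\wedge1=i$, $0\vee i=i\vee0=i$, $1\vee i=i\vee1=1$; (G4) $\delta_0,\delta_1$ disjoint; (G5) $\delta_0,\delta_1$ cofibrations; (G6) every map factors as cofibration followed by trivial fibration; (G7) every $0\to X$ is a cofibration. For $f\colon X\to Y$, $P_Y(X)$ is the pullback of $f^{\mathbb{I}}\colon X^{\mathbb{I}}\to Y^{\mathbb{I}}$ along the constant-path map $Y\to Y^{\mathbb{I}}$, with induced map $P_Y(X)\to X\times_YX$; $f$ is an hproposition if it is a fibration and this map is a trivial fibration. -}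

module Defs where

open import Level using (Level; _⊔_) renaming (suc to lsuc)
open import Data.Product using (Σ; _×_; _,_; proj₁)
open import Relation.Binary.PropositionalEquality using (_≡_)

record Category (o ℓ : Level) : Set (lsuc (o ⊔ ℓ)) where
  infixr 9 _∘_
  infix 4 _⇒_
  field
    Obj : Set o
    _⇒_ : Obj → Obj → Set ℓ
    id : ∀ {A} → A ⇒ A
    _∘_ : ∀ {A B C} → B ⇒ C → A ⇒ B → A ⇒ C
    identityˡ : ∀ {A B} {f : A ⇒ B} → id ∘ f ≡ f
    identityʳ : ∀ {A B} {f : A ⇒ B} → f ∘ id ≡ f
    assoc : ∀ {A B C D} {f : A ⇒ B} {g : B ⇒ C} {h : C ⇒ D} →
            (h ∘ g) ∘ f ≡ h ∘ (g ∘ f)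

module Notions {o ℓ : Level} (𝒞 : Category o ℓ) where
  open Category 𝒞

  Mono : ∀ {A B} → A ⇒ B → Set (o ⊔ ℓ)
  Mono {A} f = ∀ {Z} (g h : Z ⇒ A) → f ∘ g ≡ f ∘ h → g ≡ h

  IsInitial : Obj → Set (o ⊔ ℓ)
  IsInitial I = ∀ X → Σ (I ⇒ X) λ u → ∀ g → g ≡ u

  IsTerminal : Obj → Set (o ⊔ ℓ)
  IsTerminal T = ∀ X → Σ (X ⇒ T) λ u → ∀ g → g ≡ u

  record IsPullback {A B C P : Obj} (f : A ⇒ C) (g : B ⇒ C)
                    (p₁ : P ⇒ A) (p₂ : P ⇒ B) : Set (o ⊔ ℓ) where
    field
      commute : f ∘ p₁ ≡ g ∘ p₂
      universal : ∀ {Z} (h : Z ⇒ A) (k : Z ⇒ B) → f ∘ h ≡ g ∘ k → Z ⇒ P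
      p₁∘universal : ∀ {Z} {h : Z ⇒ A} {k : Z ⇒ B} (eq : f ∘ h ≡ g ∘ k) →
                     p₁ ∘ universal h k eq ≡ h
      p₂∘universal : ∀ {Z} {h : Z ⇒ A} {k : Z ⇒ B} (eq : f ∘ h ≡ g ∘ k) →
                     p₂ ∘ universal h k eq ≡ k
      unique : ∀ {Z} {h : Z ⇒ A} {k : Z ⇒ B} (eq : f ∘ h ≡ g ∘ k) (u : Z ⇒ P) →
               p₁ ∘ u ≡ h → p₂ ∘ u ≡ k → u ≡ universal h k eq

  record Pullback {A B C : Obj} (f : A ⇒ C) (g : B ⇒ C) : Set (o ⊔ ℓ) where
    field
      P : Obj
      p₁ : P ⇒ A
      p₂ : P ⇒ B
      isPullback : IsPullback f g p₁ p₂

  record IsPushout {A B C Q : Obj} (f : A ⇒ B) (g : A ⇒ C)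
                   (i₁ : B ⇒ Q) (i₂ : C ⇒ Q) : Set (o ⊔ ℓ) where
    field
      commute : i₁ ∘ f ≡ i₂ ∘ g
      universal : ∀ {Z} (h : B ⇒ Z) (k : C ⇒ Z) → h ∘ f ≡ k ∘ g → Q ⇒ Z
      universal∘i₁ : ∀ {Z} {h : B ⇒ Z} {k : C ⇒ Z} (eq : h ∘ f ≡ k ∘ g) →
                     universal h k eq ∘ i₁ ≡ h
      universal∘i₂ : ∀ {Z} {h : B ⇒ Z} {k : C ⇒ Z} (eq : h ∘ f ≡ k ∘ g) →
                     universal h k eq ∘ i₂ ≡ k
      unique : ∀ {Z} {h : B ⇒ Z} {k : C ⇒ Z} (eq : h ∘ f ≡ k ∘ g) (u : Q ⇒ Z) →
               u ∘ i₁ ≡ h → u ∘ i₂ ≡ k → u ≡ universal h k eq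

  record Pushout {A B C : Obj} (f : A ⇒ B) (g : A ⇒ C) : Set (o ⊔ ℓ) where
    field
      Q : Obj
      i₁ : B ⇒ Q
      i₂ : C ⇒ Q
      isPushout : IsPushout f g i₁ i₂

  record IsProduct {A B P : Obj} (π₁ : P ⇒ A) (π₂ : P ⇒ B) : Set (o ⊔ ℓ) where
    field
      pair : ∀ {Z} → Z ⇒ A → Z ⇒ B → Z ⇒ P
      π₁∘pair : ∀ {Z} {h : Z ⇒ A} {k : Z ⇒ B} → π₁ ∘ pair h k ≡ h
      π₂∘pair : ∀ {Z} {h : Z ⇒ A} {k : Z ⇒ B} → π₂ ∘ pair h k ≡ k
      unique : ∀ {Z} {h : Z ⇒ A} {k : Z ⇒ B} (u : Z ⇒ P) →
               π₁ ∘ u ≡ h → π₂ ∘ u ≡ k → u ≡ pair h k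

  record Product (A B : Obj) : Set (o ⊔ ℓ) where
    field
      A×B : Obj
      π₁ : A×B ⇒ A
      π₂ : A×B ⇒ B
      isProduct : IsProduct π₁ π₂

  _⋔_ : ∀ {A B X Y} → A ⇒ B → X ⇒ Y → Set ℓ
  _⋔_ {A} {B} {X} {Y} c p =
    (u : A ⇒ X) (v : B ⇒ Y) → p ∘ u ≡ v ∘ c →
    Σ (B ⇒ X) λ d → (d ∘ c ≡ u) × (p ∘ d ≡ v)

  record IsUnion {A₀ A₁ B U : Obj} (m₀ : A₀ ⇒ B) (m₁ : A₁ ⇒ B) (m : U ⇒ B)
                 : Set (o ⊔ ℓ) where
    field
      mono : Mono m
      ι₀ : A₀ ⇒ U
      ι₀-factor : m ∘ ι₀ ≡ m₀
      ι₁ : A₁ ⇒ U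
      ι₁-factor : m ∘ ι₁ ≡ m₁
      least : ∀ {V} (n : V ⇒ B) → Mono n →
              Σ (A₀ ⇒ V) (λ j → n ∘ j ≡ m₀) →
              Σ (A₁ ⇒ V) (λ j → n ∘ j ≡ m₁) →
              Σ (U ⇒ V) (λ k → n ∘ k ≡ m)

  -- local cartesian closure: for every f : A → B, pullback along f has a
  -- right adjoint Π_f, expressed by the universal property of Π_f(p) with
  -- its counit  ev : f*(Π_f p) → E  over A (pullbacks taken as given ones).
  HasDependentProducts : (pb : ∀ {A B C} (f : A ⇒ C) (g : B ⇒ C) → Pullback f g) →
                         Set (o ⊔ ℓ)
  HasDependentProducts pb =
    ∀ {A B E} (f : A ⇒ B) (p : E ⇒ A) →
    Σ Obj λ Π → Σ (Π ⇒ B) λ q →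
    Σ (Pullback.P (pb f q) ⇒ E) λ ev →
    (p ∘ ev ≡ Pullback.p₁ (pb f q)) ×
    (∀ {Z} (r : Z ⇒ B) (h : Pullback.P (pb f r) ⇒ E) →
       p ∘ h ≡ Pullback.p₁ (pb f r) →
       let Transposes : Z ⇒ Π → Set ℓ
           Transposes k = (q ∘ k ≡ r) ×
             (∀ (u : Pullback.P (pb f r) ⇒ Pullback.P (pb f q)) →
                Pullback.p₁ (pb f q) ∘ u ≡ Pullback.p₁ (pb f r) →
                Pullback.p₂ (pb f q) ∘ u ≡ k ∘ Pullback.p₂ (pb f r) →
                ev ∘ u ≡ h)
       in Σ (Z ⇒ Π) λ k → Transposes k × (∀ k' → Transposes k' → k' ≡ k))

record Setting (o ℓ c : Level) : Set (lsuc (o ⊔ ℓ ⊔ c)) where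
  field
    𝒞 : Category o ℓ
  open Category 𝒞 public
  open Notions 𝒞 public
  field
    𝟙 : Obj
    𝟙-terminal : IsTerminal 𝟙
    product : ∀ A B → Product A B
    pullback : ∀ {A B C} (f : A ⇒ C) (g : B ⇒ C) → Pullback f g
    lcc : HasDependentProducts pullback
    𝟘 : Obj
    𝟘-initial : IsInitial 𝟘
    pushout : ∀ {A B C} (f : A ⇒ B) (g : A ⇒ C) → Pushout f g

  infixr 7 _×₀_
  _×₀_ : Obj → Obj → Obj
  A ×₀ B = Product.A×B (product A B)

  π₁ : ∀ {A B} → A ×₀ B ⇒ A
  π₁ {A} {B} = Product.π₁ (product A B)

  π₂ : ∀ {A B} → A ×₀ B ⇒ B
  π₂ {A} {B} = Product.π₂ (product A B)

  ⟨_,_⟩ : ∀ {Z A B} → Z ⇒ A → Z ⇒ B → Z ⇒ A ×₀ B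
  ⟨_,_⟩ {Z} {A} {B} h k = IsProduct.pair (Product.isProduct (product A B)) h k

  _×₁_ : ∀ {A B C D} → A ⇒ C → B ⇒ D → A ×₀ B ⇒ C ×₀ D
  f ×₁ g = ⟨ f ∘ π₁ , g ∘ π₂ ⟩

  ! : ∀ {X} → X ⇒ 𝟙
  ! {X} = proj₁ (𝟙-terminal X)

  ¡ : ∀ {X} → 𝟘 ⇒ X
  ¡ {X} = proj₁ (𝟘-initial X)

  field
    -- cartesian closure (a consequence of lcc + terminal object; chosen here)
    _^_ : Obj → Obj → Obj
    ev : ∀ {X I} → (X ^ I) ×₀ I ⇒ X
    curry : ∀ {Z X I} → Z ×₀ I ⇒ X → Z ⇒ X ^ I
    curry-β : ∀ {Z X I} {h : Z ×₀ I ⇒ X} → ev ∘ (curry h ×₁ id) ≡ h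
    curry-unique : ∀ {Z X I} {h : Z ×₀ I ⇒ X} (g : Z ⇒ X ^ I) →
                   ev ∘ (g ×₁ id) ≡ h → g ≡ curry h
    Cof : ∀ {A B} → A ⇒ B → Set c
    𝕀 : Obj
    δ₀ δ₁ : 𝟙 ⇒ 𝕀
    G1 : ∀ {A B C P} (m : A ⇒ C) (g : B ⇒ C) (p₁ : P ⇒ A) (p₂ : P ⇒ B) →
         IsPullback m g p₁ p₂ → Cof m → Cof p₂
    G2 : ∀ {A₀ A₁ B U} (m₀ : A₀ ⇒ B) (m₁ : A₁ ⇒ B) (m : U ⇒ B) →
         Mono m₀ → Mono m₁ → IsUnion m₀ m₁ m → Cof m₀ → Cof m₁ → Cof m
    _∧_ _∨_ : 𝕀 ×₀ 𝕀 ⇒ 𝕀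
    ∧-0l : _∧_ ∘ ⟨ δ₀ ∘ ! , id ⟩ ≡ δ₀ ∘ !
    ∧-0r : _∧_ ∘ ⟨ id , δ₀ ∘ ! ⟩ ≡ δ₀ ∘ !
    ∧-1l : _∧_ ∘ ⟨ δ₁ ∘ ! , id ⟩ ≡ id
    ∧-1r : _∧_ ∘ ⟨ id , δ₁ ∘ ! ⟩ ≡ id
    ∨-0l : _∨_ ∘ ⟨ δ₀ ∘ ! , id ⟩ ≡ id
    ∨-0r : _∨_ ∘ ⟨ id , δ₀ ∘ ! ⟩ ≡ id
    ∨-1l : _∨_ ∘ ⟨ δ₁ ∘ ! , id ⟩ ≡ δ₁ ∘ !
    ∨-1r : _∨_ ∘ ⟨ id , δ₁ ∘ ! ⟩ ≡ δ₁ ∘ !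
    G4 : ∀ {P} (p₁ p₂ : P ⇒ 𝟙) → IsPullback δ₀ δ₁ p₁ p₂ → IsInitial P
    G5₀ : Cof δ₀
    G5₁ : Cof δ₁
    G6 : ∀ {A B} (f : A ⇒ B) →
         Σ Obj λ M → Σ (A ⇒ M) λ i → Σ (M ⇒ B) λ p →
         Cof i × (∀ {A' B'} (c' : A' ⇒ B') → Cof c' → c' ⋔ p) × (p ∘ i ≡ f)
    G7 : ∀ {X} → Cof (¡ {X})

module Fibrations {o ℓ c : Level} (S : Setting o ℓ c) where
  open Setting S

  TrivFib : ∀ {X Y} → X ⇒ Y → Set (o ⊔ ℓ ⊔ c)
  TrivFib p = ∀ {A B} (m : A ⇒ B) → Cof m → m ⋔ p

  -- f has the RLP against the pushout product  δ ×̂ m : (𝕀 × A) ∪_{𝟙 × A} (𝟙 × B) → 𝕀 × B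
  -- (the pushout product is the unique map out of the pushout with the given restrictions)
  LiftsAgainstPushoutProduct : ∀ {A B X Y} → 𝟙 ⇒ 𝕀 → A ⇒ B → X ⇒ Y → Set ℓ
  LiftsAgainstPushoutProduct {A} {B} δ m f =
    let Po = pushout (δ ×₁ id {A}) (id {𝟙} ×₁ m) in
    (g : Pushout.Q Po ⇒ 𝕀 ×₀ B) →
    g ∘ Pushout.i₁ Po ≡ id ×₁ m →
    g ∘ Pushout.i₂ Po ≡ δ ×₁ id →
    g ⋔ f

  Fib : ∀ {X Y} → X ⇒ Y → Set (o ⊔ ℓ ⊔ c)
  Fib f = ∀ {A B} (m : A ⇒ B) → Cof m →
          LiftsAgainstPushoutProduct δ₀ m f × LiftsAgainstPushoutProduct δ₁ m f

  module PathObj {X Y} (f : X ⇒ Y) where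
    f^𝕀 : X ^ 𝕀 ⇒ Y ^ 𝕀
    f^𝕀 = curry (f ∘ ev)

    const : Y ⇒ Y ^ 𝕀
    const = curry π₁

    PY : Pullback f^𝕀 const
    PY = pullback f^𝕀 const

    X×YX : Pullback f f
    X×YX = pullback f f

    endpoint : 𝟙 ⇒ 𝕀 → Pullback.P PY ⇒ X
    endpoint δ = ev ∘ ⟨ Pullback.p₁ PY , δ ∘ ! ⟩

  HProp : ∀ {X Y} → X ⇒ Y → Set (o ⊔ ℓ ⊔ c)
  HProp {X} {Y} f =
    Fib f ×
    ((r : Pullback.P PY ⇒ Pullback.P X×YX) →
       Pullback.p₁ X×YX ∘ r ≡ endpoint δ₀ →
       Pullback.p₂ X×YX ∘ r ≡ endpoint δ₁ →
       TrivFib r)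
    where open PathObj f

{-# OPTIONS --safe #-}
-- Suppose m₀ is the cofibration. First move t₁ within the fibres of f until it agrees with t₀
-- on A₀ ∩ A₁: there t₀ and t₁ lie over the same points of B, so, f being an hproposition,
-- they are joined by a path in the fibres of f; as A₀ ∩ A₁ ↪ A₁ is a cofibration (G1) and f a
-- fibration, this path extends to a fibrewise homotopy on all of A₁, whose other end is the
-- new t₁. Sections agreeing on the intersection then glue over the union, which need not be a
-- pushout: by local cartesian closure, the points of X that coincide with t₀ and t₁ wherever
-- they lie over A₀ resp. A₁, and at which f is injective, form a subobject of X mapped
-- monically to B; it contains A₀ and A₁, hence A₀ ∪ A₁.
module Submission where

open import Level using (_⊔_)
open import Defs
open import Data.Product using (Σ; _,_; proj₁; proj₂; _×_)
open import Data.Sum using (_⊎_; inj₁; inj₂)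
open import Relation.Binary.PropositionalEquality using (_≡_; refl; sym; trans; cong; cong₂; subst; module ≡-Reasoning)

module CategoryFacts {o ℓ} (𝒞 : Category o ℓ) where
  open Category 𝒞
  open Notions 𝒞
  open ≡-Reasoning

  pullˡ : ∀ {A B C D} {a : C ⇒ D} {b : B ⇒ C} {e : B ⇒ D} {x : A ⇒ B} →
          a ∘ b ≡ e → a ∘ (b ∘ x) ≡ e ∘ x
  pullˡ {x = x} p = trans (sym assoc) (cong (_∘ x) p)

  section⇒mono : ∀ {A B} {s : A ⇒ B} (r : B ⇒ A) → r ∘ s ≡ id → Mono s
  section⇒mono {s = s} r rs a b e = begin
    a             ≡⟨ sym identityˡ ⟩
    id ∘ a        ≡⟨ sym (pullˡ rs) ⟩
    r ∘ (s ∘ a)   ≡⟨ cong (r ∘_) e ⟩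
    r ∘ (s ∘ b)   ≡⟨ pullˡ rs ⟩
    id ∘ b        ≡⟨ identityˡ ⟩
    b             ∎

  module _ {A B C P} {f : A ⇒ C} {g : B ⇒ C} {p₁ : P ⇒ A} {p₂ : P ⇒ B}
           (pb : IsPullback f g p₁ p₂) where
    open IsPullback pb

    commute∘ : ∀ {Z} (a : Z ⇒ P) → f ∘ (p₁ ∘ a) ≡ g ∘ (p₂ ∘ a)
    commute∘ a = trans (pullˡ commute) assoc

    pullback-jointly-mono : ∀ {Z} {a b : Z ⇒ P} → p₁ ∘ a ≡ p₁ ∘ b → p₂ ∘ a ≡ p₂ ∘ b → a ≡ b
    pullback-jointly-mono {a = a} {b} e₁ e₂ =
      trans (unique (commute∘ a) a refl refl) (sym (unique (commute∘ a) b (sym e₁) (sym e₂)))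

  pushout-jointly-epi : ∀ {A B C Q} {f : A ⇒ B} {g : A ⇒ C} {i₁ : B ⇒ Q} {i₂ : C ⇒ Q} →
    IsPushout f g i₁ i₂ → ∀ {Z} {a b : Q ⇒ Z} → a ∘ i₁ ≡ b ∘ i₁ → a ∘ i₂ ≡ b ∘ i₂ → a ≡ b
  pushout-jointly-epi po {a = a} {b} e₁ e₂ =
    trans (unique eq a refl refl) (sym (unique eq b (sym e₁) (sym e₂)))
    where
      open IsPushout po
      eq = trans assoc (trans (cong (a ∘_) commute) (sym assoc))

  Agree : ∀ {A₀ A₁ B X} → A₀ ⇒ B → A₁ ⇒ B → A₀ ⇒ X → A₁ ⇒ X → Set (o ⊔ ℓ)
  Agree {A₀} {A₁} m₀ m₁ t₀ t₁ =
    ∀ {W} (w₀ : W ⇒ A₀) (w₁ : W ⇒ A₁) → m₀ ∘ w₀ ≡ m₁ ∘ w₁ → t₀ ∘ w₀ ≡ t₁ ∘ w₁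

  Agree-sym : ∀ {A₀ A₁ B X} {m₀ : A₀ ⇒ B} {m₁ : A₁ ⇒ B} {t₀ : A₀ ⇒ X} {t₁ : A₁ ⇒ X} →
              Agree m₀ m₁ t₀ t₁ → Agree m₁ m₀ t₁ t₀
  Agree-sym agree w₁ w₀ e = sym (agree w₀ w₁ (sym e))

  Agree-refl : ∀ {A B X} {m : A ⇒ B} {t : A ⇒ X} → Mono m → Agree m m t t
  Agree-refl m-mono w₀ w₁ e = cong (_ ∘_) (m-mono w₀ w₁ e)

  Agree-on-pullback : ∀ {A₀ A₁ B X P} {m₀ : A₀ ⇒ B} {m₁ : A₁ ⇒ B} {p₀ : P ⇒ A₀} {p₁ : P ⇒ A₁}
    {t₀ : A₀ ⇒ X} {t₁ : A₁ ⇒ X} → IsPullback m₀ m₁ p₀ p₁ → t₀ ∘ p₀ ≡ t₁ ∘ p₁ → Agree m₀ m₁ t₀ t₁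
  Agree-on-pullback {p₀ = p₀} {p₁} {t₀} {t₁} pb e w₀ w₁ mw = begin
    t₀ ∘ w₀          ≡⟨ cong (t₀ ∘_) (sym (p₁∘universal mw)) ⟩
    t₀ ∘ (p₀ ∘ z)    ≡⟨ pullˡ e ⟩
    (t₁ ∘ p₁) ∘ z    ≡⟨ assoc ⟩
    t₁ ∘ (p₁ ∘ z)    ≡⟨ cong (t₁ ∘_) (p₂∘universal mw) ⟩
    t₁ ∘ w₁          ∎
    where
      open IsPullback pb
      z = universal w₀ w₁ mw

  Factors : ∀ {W R E} → W ⇒ R → E ⇒ R → Set ℓ
  Factors {W} {E = E} w e = Σ (W ⇒ E) λ y → e ∘ y ≡ w

  -- The subobject {x ∣ P x} of X, for P a predicate on generalised elements of X.
  record Comprehension {X} (P : ∀ {Z} → Z ⇒ X → Set (o ⊔ ℓ)) : Set (o ⊔ ℓ) where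
    field
      {Carrier} : Obj
      incl : Carrier ⇒ X
      incl-mono : Mono incl
      factor : ∀ {Z} (x : Z ⇒ X) → P x → Factors x incl
      holds : ∀ {Z} (k : Z ⇒ Carrier) → P (incl ∘ k)

  open Comprehension public

  Comprehension-resp : ∀ {X} {P Q : ∀ {Z} → Z ⇒ X → Set (o ⊔ ℓ)} →
    (∀ {Z} (x : Z ⇒ X) → P x → Q x) → (∀ {Z} (x : Z ⇒ X) → Q x → P x) →
    Comprehension P → Comprehension Q
  Comprehension-resp P⇒Q Q⇒P C = record
    { incl = incl C
    ; incl-mono = incl-mono C
    ; factor = λ x q → factor C x (Q⇒P x q)
    ; holds = λ k → P⇒Q _ (holds C k)
    }

  InjectiveAt : ∀ {S B} → S ⇒ B → ∀ {Z} → Z ⇒ S → Set (o ⊔ ℓ)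
  InjectiveAt {S} g {Z} y = ∀ {W} (y′ : W ⇒ S) (z : W ⇒ Z) → g ∘ y′ ≡ g ∘ (y ∘ z) → y′ ≡ y ∘ z

  injectivity-locus-mono : ∀ {S B} {g : S ⇒ B} (L : Comprehension (InjectiveAt g)) →
                           Mono (g ∘ incl L)
  injectivity-locus-mono {g = g} L a b e =
    incl-mono L a b (trans (holds L b (incl L ∘ a) id (trans e′ (cong (g ∘_) (sym identityʳ))))
                           identityʳ)
    where
      e′ : g ∘ (incl L ∘ a) ≡ g ∘ (incl L ∘ b)
      e′ = trans (sym assoc) (trans e assoc)

module Construction {o ℓ c} (S : Setting o ℓ c) where
  open Setting S
  open Fibrations S
  open CategoryFacts 𝒞
  open ≡-Reasoning

  π₁∘⟨⟩ : ∀ {Z A B} {h : Z ⇒ A} {k : Z ⇒ B} → π₁ ∘ ⟨ h , k ⟩ ≡ h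
  π₁∘⟨⟩ {A = A} {B} = IsProduct.π₁∘pair (Product.isProduct (product A B))

  π₂∘⟨⟩ : ∀ {Z A B} {h : Z ⇒ A} {k : Z ⇒ B} → π₂ ∘ ⟨ h , k ⟩ ≡ k
  π₂∘⟨⟩ {A = A} {B} = IsProduct.π₂∘pair (Product.isProduct (product A B))

  ⟨⟩-unique : ∀ {Z A B} {h : Z ⇒ A} {k : Z ⇒ B} (u : Z ⇒ A ×₀ B) →
              π₁ ∘ u ≡ h → π₂ ∘ u ≡ k → u ≡ ⟨ h , k ⟩
  ⟨⟩-unique {A = A} {B} = IsProduct.unique (Product.isProduct (product A B))

  ⟨⟩∘ : ∀ {Y Z A B} {h : Z ⇒ A} {k : Z ⇒ B} {z : Y ⇒ Z} → ⟨ h , k ⟩ ∘ z ≡ ⟨ h ∘ z , k ∘ z ⟩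
  ⟨⟩∘ = ⟨⟩-unique _ (pullˡ π₁∘⟨⟩) (pullˡ π₂∘⟨⟩)

  ×₁∘⟨⟩ : ∀ {Z A B C D} {g : A ⇒ C} {h : B ⇒ D} {a : Z ⇒ A} {b : Z ⇒ B} →
          (g ×₁ h) ∘ ⟨ a , b ⟩ ≡ ⟨ g ∘ a , h ∘ b ⟩
  ×₁∘⟨⟩ {g = g} {h} =
    trans ⟨⟩∘ (cong₂ ⟨_,_⟩ (trans assoc (cong (g ∘_) π₁∘⟨⟩)) (trans assoc (cong (h ∘_) π₂∘⟨⟩)))

  ×₁∘×₁ : ∀ {A B C D E F} {a : C ⇒ E} {b : D ⇒ F} {a′ : A ⇒ C} {b′ : B ⇒ D} →
          (a ×₁ b) ∘ (a′ ×₁ b′) ≡ (a ∘ a′) ×₁ (b ∘ b′)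
  ×₁∘×₁ = trans ×₁∘⟨⟩ (cong₂ ⟨_,_⟩ (sym assoc) (sym assoc))

  ×₁-interchange : ∀ {A B C D} {a : A ⇒ B} {b : C ⇒ D} → (id ×₁ b) ∘ (a ×₁ id) ≡ (a ×₁ id) ∘ (id ×₁ b)
  ×₁-interchange = trans ×₁∘×₁ (trans (cong₂ _×₁_ (trans identityˡ (sym identityʳ))
                                                  (trans identityʳ (sym identityˡ)))
                                      (sym ×₁∘×₁))

  !-unique : ∀ {X} (g : X ⇒ 𝟙) → g ≡ !
  !-unique {X} = proj₂ (𝟙-terminal X)

  ¡-unique : ∀ {X} (g : 𝟘 ⇒ X) → g ≡ ¡
  ¡-unique {X} = proj₂ (𝟘-initial X)

  face : ∀ {Z} → 𝟙 ⇒ 𝕀 → Z ⇒ 𝕀 ×₀ Z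
  face δ = ⟨ δ ∘ ! , id ⟩

  π₂∘face : ∀ {Z} {δ : 𝟙 ⇒ 𝕀} → π₂ ∘ face {Z} δ ≡ id
  π₂∘face = π₂∘⟨⟩

  face-natural : ∀ {Y Z} {δ : 𝟙 ⇒ 𝕀} {z : Y ⇒ Z} → face δ ∘ z ≡ (id ×₁ z) ∘ face δ
  face-natural {δ = δ} = trans ⟨⟩∘ (trans (cong₂ ⟨_,_⟩ const-path (trans identityˡ (sym identityʳ)))
                                          (sym ×₁∘⟨⟩))
    where const-path = trans assoc (trans (cong (δ ∘_) (!-unique _)) (sym identityˡ))

  δ×id≡face∘π₂ : ∀ {Z} (δ : 𝟙 ⇒ 𝕀) → δ ×₁ id {Z} ≡ face δ ∘ π₂
  δ×id≡face∘π₂ δ = sym (trans ⟨⟩∘ (cong₂ ⟨_,_⟩ (trans assoc (cong (δ ∘_) (trans (!-unique _) (sym (!-unique _)))))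
                                                (trans identityˡ (sym identityˡ))))

  fib-homotopy-extension : ∀ {A B′ X Y} {f : X ⇒ Y} {c : A ⇒ B′} → Fib f → Cof c →
    (b : B′ ⇒ Y) (H : 𝕀 ×₀ A ⇒ X) (t : B′ ⇒ X) →
    f ∘ H ≡ (b ∘ c) ∘ π₂ → f ∘ t ≡ b → H ∘ face δ₁ ≡ t ∘ c →
    Σ (B′ ⇒ X) λ t′ → (f ∘ t′ ≡ b) × (t′ ∘ c ≡ H ∘ face δ₀)
  fib-homotopy-extension {A} {B′} {f = f} {c} fib cof b H t fH ft H₁ =
    t′ , ft′ , t′c
    where
      Po = pushout (δ₁ ×₁ id {A}) (id {𝟙} ×₁ c)
      open Pushout Po using (i₁; i₂; isPushout)
      open IsPushout isPushout using (universal; universal∘i₁; universal∘i₂)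

      g = universal (id ×₁ c) (δ₁ ×₁ id) ×₁-interchange
      gi₁ = universal∘i₁ ×₁-interchange
      gi₂ = universal∘i₂ ×₁-interchange

      H-t : H ∘ (δ₁ ×₁ id) ≡ (t ∘ π₂) ∘ (id ×₁ c)
      H-t = begin
        H ∘ (δ₁ ×₁ id)            ≡⟨ cong (H ∘_) (δ×id≡face∘π₂ δ₁) ⟩
        H ∘ (face δ₁ ∘ π₂)        ≡⟨ pullˡ H₁ ⟩
        (t ∘ c) ∘ π₂              ≡⟨ assoc ⟩
        t ∘ (c ∘ π₂)              ≡⟨ cong (t ∘_) (sym π₂∘⟨⟩) ⟩
        t ∘ (π₂ ∘ (id ×₁ c))      ≡⟨ sym assoc ⟩
        (t ∘ π₂) ∘ (id ×₁ c)      ∎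

      u = universal H (t ∘ π₂) H-t

      b∘π₂∘g : ∀ {Z} {k : Z ⇒ Pushout.Q Po} {a : Z ⇒ 𝕀 ×₀ B′} →
               g ∘ k ≡ a → (b ∘ π₂) ∘ (g ∘ k) ≡ b ∘ (π₂ ∘ a)
      b∘π₂∘g gk = trans assoc (cong (λ v → b ∘ (π₂ ∘ v)) gk)

      square : f ∘ u ≡ (b ∘ π₂) ∘ g
      square = pushout-jointly-epi isPushout
        (trans assoc (trans (cong (f ∘_) (universal∘i₁ H-t))
               (trans fH (sym (trans assoc (trans (b∘π₂∘g gi₁) (trans (cong (b ∘_) π₂∘⟨⟩) (sym assoc))))))))
        (trans assoc (trans (cong (f ∘_) (universal∘i₂ H-t))
               (trans (pullˡ ft) (sym (trans assoc (trans (b∘π₂∘g gi₂) (cong (b ∘_) (trans π₂∘⟨⟩ identityˡ))))))))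

      lift = proj₂ (fib c cof) g gi₁ gi₂ u (b ∘ π₂) square
      d = proj₁ lift

      t′ = d ∘ face δ₀

      ft′ : f ∘ t′ ≡ b
      ft′ = trans (pullˡ (proj₂ (proj₂ lift))) (trans assoc (trans (cong (b ∘_) π₂∘face) identityʳ))

      d-on-cylinder : d ∘ (id ×₁ c) ≡ H
      d-on-cylinder = trans (cong (d ∘_) (sym gi₁)) (trans (pullˡ (proj₁ (proj₂ lift))) (universal∘i₁ H-t))

      t′c : t′ ∘ c ≡ H ∘ face δ₀
      t′c = trans assoc (trans (cong (d ∘_) face-natural) (pullˡ d-on-cylinder))

  module PathsOver {X B} (f : X ⇒ B) where
    open PathObj f public
    open Pullback PY renaming (p₁ to path; p₂ to base)

    ev-over-const : ∀ {Z} (a : Z ⇒ X ^ 𝕀) (b : Z ⇒ B) (i : Z ⇒ 𝕀) →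
                    f^𝕀 ∘ a ≡ const ∘ b → f ∘ (ev ∘ ⟨ a , i ⟩) ≡ b
    ev-over-const a b i e = begin
      f ∘ (ev ∘ ⟨ a , i ⟩)                ≡⟨ sym assoc ⟩
      (f ∘ ev) ∘ ⟨ a , i ⟩                ≡⟨ cong (_∘ ⟨ a , i ⟩) (sym curry-β) ⟩
      (ev ∘ (f^𝕀 ×₁ id)) ∘ ⟨ a , i ⟩      ≡⟨ trans assoc (cong (ev ∘_) ×₁∘⟨⟩) ⟩
      ev ∘ ⟨ f^𝕀 ∘ a , id ∘ i ⟩           ≡⟨ cong (λ v → ev ∘ ⟨ v , id ∘ i ⟩) e ⟩
      ev ∘ ⟨ const ∘ b , id ∘ i ⟩         ≡⟨ cong (ev ∘_) (sym ×₁∘⟨⟩) ⟩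
      ev ∘ ((const ×₁ id) ∘ ⟨ b , i ⟩)    ≡⟨ pullˡ curry-β ⟩
      π₁ ∘ ⟨ b , i ⟩                      ≡⟨ π₁∘⟨⟩ ⟩
      b                                   ∎

    endpoint-over : ∀ δ → f ∘ endpoint δ ≡ base
    endpoint-over δ = ev-over-const path base (δ ∘ !) (IsPullback.commute isPullback)

    hprop-path : HProp f → ∀ {Z} (u v : Z ⇒ X) → f ∘ u ≡ f ∘ v →
                 Σ (Z ⇒ P) λ γ → (endpoint δ₀ ∘ γ ≡ u) × (endpoint δ₁ ∘ γ ≡ v)
    hprop-path hp u v fuv = γ , end₀ , end₁
      where
        open IsPullback (Pullback.isPullback X×YX)
        ends = trans (endpoint-over δ₀) (sym (endpoint-over δ₁))
        r = universal (endpoint δ₀) (endpoint δ₁) ends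
        lift = proj₂ hp r (p₁∘universal ends) (p₂∘universal ends) ¡ G7 ¡ (universal u v fuv)
                 (trans (¡-unique _) (sym (¡-unique _)))
        γ = proj₁ lift
        rγ = proj₂ (proj₂ lift)
        end₀ = trans (cong (_∘ γ) (sym (p₁∘universal ends)))
                     (trans assoc (trans (cong (Pullback.p₁ X×YX ∘_) rγ) (p₁∘universal fuv)))
        end₁ = trans (cong (_∘ γ) (sym (p₂∘universal ends)))
                     (trans assoc (trans (cong (Pullback.p₂ X×YX ∘_) rγ) (p₂∘universal fuv)))

    homotopy : ∀ {Z} → Z ⇒ P → 𝕀 ×₀ Z ⇒ X
    homotopy γ = ev ∘ ⟨ path ∘ (γ ∘ π₂) , π₁ ⟩

    homotopy-over : ∀ {Z} (γ : Z ⇒ P) → f ∘ homotopy γ ≡ (base ∘ γ) ∘ π₂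
    homotopy-over γ = trans (ev-over-const _ _ _ (trans (pullˡ (IsPullback.commute isPullback)) assoc))
                            (sym assoc)

    homotopy-face : ∀ {Z} (γ : Z ⇒ P) δ → homotopy γ ∘ face δ ≡ endpoint δ ∘ γ
    homotopy-face γ δ = begin
      homotopy γ ∘ face δ                                   ≡⟨ trans assoc (cong (ev ∘_) ⟨⟩∘) ⟩
      ev ∘ ⟨ (path ∘ (γ ∘ π₂)) ∘ face δ , π₁ ∘ face δ ⟩    ≡⟨ cong₂ (λ a i → ev ∘ ⟨ a , i ⟩) path-at π₁∘⟨⟩ ⟩
      ev ∘ ⟨ path ∘ γ , δ ∘ ! ⟩                             ≡⟨ cong (λ i → ev ∘ ⟨ path ∘ γ , i ⟩) const-at ⟩
      ev ∘ ⟨ path ∘ γ , (δ ∘ !) ∘ γ ⟩                       ≡⟨ trans (cong (ev ∘_) (sym ⟨⟩∘)) (sym assoc) ⟩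
      endpoint δ ∘ γ                                        ∎
      where
        path-at = trans assoc (cong (path ∘_) (trans assoc (trans (cong (γ ∘_) π₂∘face) identityʳ)))
        const-at = sym (trans assoc (cong (δ ∘_) (!-unique _)))

  realign : ∀ {A₀ A₁ B X} {m₀ : A₀ ⇒ B} {m₁ : A₁ ⇒ B} {f : X ⇒ B} {t₀ : A₀ ⇒ X} {t₁ : A₁ ⇒ X} →
    Cof m₀ → HProp f → f ∘ t₀ ≡ m₀ → f ∘ t₁ ≡ m₁ →
    Σ (A₁ ⇒ X) λ t₁′ → (f ∘ t₁′ ≡ m₁) × Agree m₀ m₁ t₀ t₁′
  realign {m₀ = m₀} {m₁} {f} {t₀} {t₁} cof hp ft₀ ft₁ =
    t₁′ , ft₁′ , Agree-on-pullback pb (sym t₁′-on-intersection)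
    where
      open PathsOver f
      open Pullback (pullback m₀ m₁) renaming (p₁ to p₀; p₂ to p₁; isPullback to pb)

      over-intersection : f ∘ (t₀ ∘ p₀) ≡ f ∘ (t₁ ∘ p₁)
      over-intersection = trans (pullˡ ft₀) (trans (IsPullback.commute pb) (sym (pullˡ ft₁)))

      joined = hprop-path hp (t₀ ∘ p₀) (t₁ ∘ p₁) over-intersection
      γ = proj₁ joined
      H = homotopy γ

      base-γ : Pullback.p₂ PY ∘ γ ≡ m₁ ∘ p₁
      base-γ = begin
        Pullback.p₂ PY ∘ γ      ≡⟨ cong (_∘ γ) (sym (endpoint-over δ₀)) ⟩
        (f ∘ endpoint δ₀) ∘ γ   ≡⟨ trans assoc (cong (f ∘_) (proj₁ (proj₂ joined))) ⟩
        f ∘ (t₀ ∘ p₀)           ≡⟨ trans (pullˡ ft₀) (IsPullback.commute pb) ⟩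
        m₁ ∘ p₁                 ∎

      extension = fib-homotopy-extension (proj₁ hp) (G1 m₀ m₁ p₀ p₁ pb cof) m₁ H t₁
        (trans (homotopy-over γ) (cong (_∘ π₂) base-γ)) ft₁
        (trans (homotopy-face γ δ₁) (proj₂ (proj₂ joined)))
      t₁′ = proj₁ extension
      ft₁′ = proj₁ (proj₂ extension)
      t₁′-on-intersection = trans (proj₂ (proj₂ extension)) (trans (homotopy-face γ δ₀) (proj₁ (proj₂ joined)))

  ∀-along : ∀ {R X E} (p : R ⇒ X) (e : E ⇒ R) → Mono e →
    Comprehension (λ {Z} x → ∀ {W} (w : W ⇒ R) (z : W ⇒ Z) → p ∘ w ≡ x ∘ z → Factors w e)
  ∀-along {R} {X} {E} p e e-mono = record
    { incl = q ; incl-mono = q-mono ; factor = factor′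
    ; holds = λ k w z eq → elim w (k ∘ z) (trans eq assoc) }
    where
      D = lcc p e
      q = proj₁ (proj₂ D)
      ev′ = proj₁ (proj₂ (proj₂ D))
      ev′-over = proj₁ (proj₂ (proj₂ (proj₂ D)))
      transpose = proj₂ (proj₂ (proj₂ (proj₂ D)))

      elim : ∀ {W} (w : W ⇒ R) (z : W ⇒ proj₁ D) → p ∘ w ≡ q ∘ z → Factors w e
      elim w z eq = ev′ ∘ universal w z eq , trans (pullˡ ev′-over) (p₁∘universal eq)
        where open IsPullback (Pullback.isPullback (pullback p q))

      factor′ : ∀ {Z} (x : Z ⇒ X) →
        (∀ {W} (w : W ⇒ R) (z : W ⇒ Z) → p ∘ w ≡ x ∘ z → Factors w e) → Factors x q
      factor′ x H = proj₁ k , proj₁ (proj₁ (proj₂ k))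
        where
          open Pullback (pullback p x)
          h = H p₁ p₂ (IsPullback.commute isPullback)
          k = transpose x (proj₁ h) (proj₂ h)

      q-mono : Mono q
      q-mono a b eq = trans (unique a (transposes a refl)) (sym (unique b (transposes b (sym eq))))
        where
          open Pullback (pullback p (q ∘ a))
          h = elim p₁ (a ∘ p₂) (trans (IsPullback.commute isPullback) assoc)
          unique = proj₂ (proj₂ (transpose (q ∘ a) (proj₁ h) (proj₂ h)))
          transposes : ∀ k → q ∘ k ≡ q ∘ a → _
          transposes k qk = qk , λ u e₁ _ → e-mono _ _ (trans (pullˡ ev′-over) (trans e₁ (sym (proj₂ h))))

  agreement-subobject : ∀ {A B X} {ma : A ⇒ B} {f : X ⇒ B} {ta : A ⇒ X} → f ∘ ta ≡ ma →
                        Comprehension (λ x → Agree ma (f ∘ x) ta x)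
  agreement-subobject {ma = ma} {f} {ta} fta =
    Comprehension-resp to from (∀-along r₂ graph (section⇒mono r₁ r₁∘graph))
    where
      open Pullback (pullback ma f) renaming (p₁ to r₁; p₂ to r₂)
      open IsPullback isPullback
      graph-eq = trans identityʳ (sym fta)
      graph = universal id ta graph-eq
      r₁∘graph = p₁∘universal graph-eq

      to : ∀ {Z} (x : Z ⇒ _) → (∀ {W} (w : W ⇒ P) (z : W ⇒ Z) → r₂ ∘ w ≡ x ∘ z → Factors w graph) →
           Agree ma (f ∘ x) ta x
      to x H w₀ z e = begin
        ta ∘ w₀                ≡⟨ cong (ta ∘_) (sym y≡w₀) ⟩
        ta ∘ y                 ≡⟨ sym (pullˡ (p₂∘universal graph-eq)) ⟩
        r₂ ∘ (graph ∘ y)       ≡⟨ cong (r₂ ∘_) (proj₂ Y) ⟩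
        r₂ ∘ w                 ≡⟨ p₂∘universal e′ ⟩
        x ∘ z                  ∎
        where
          e′ = trans e assoc
          w = universal w₀ (x ∘ z) e′
          Y = H w z (p₂∘universal e′)
          y = proj₁ Y
          y≡w₀ = trans (sym (trans (pullˡ r₁∘graph) identityˡ))
                       (trans (cong (r₁ ∘_) (proj₂ Y)) (p₁∘universal e′))

      from : ∀ {Z} (x : Z ⇒ _) → Agree ma (f ∘ x) ta x →
             ∀ {W} (w : W ⇒ P) (z : W ⇒ Z) → r₂ ∘ w ≡ x ∘ z → Factors w graph
      from x agree w z e = r₁ ∘ w , pullback-jointly-mono isPullback
        (trans (pullˡ r₁∘graph) identityˡ)
        (trans (pullˡ (p₂∘universal graph-eq))
               (trans (agree (r₁ ∘ w) z (trans (commute∘ isPullback w) (trans (cong (f ∘_) e) (sym assoc))))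
                      (sym e)))

  intersection : ∀ {X} {P Q : ∀ {Z} → Z ⇒ X → Set (o ⊔ ℓ)} →
                 Comprehension P → Comprehension Q → Comprehension (λ x → P x × Q x)
  intersection {P = P} {Q} C D = record
    { incl = incl C ∘ a₁
    ; incl-mono = λ a b e →
        let e₁ = incl-mono C _ _ (trans (sym assoc) (trans e assoc)) in
        pullback-jointly-mono isPullback e₁
          (incl-mono D _ _ (trans (sym (commute∘ isPullback a))
                                  (trans (cong (incl C ∘_) e₁) (commute∘ isPullback b))))
    ; factor = λ x pq →
        let k₀ = factor C x (proj₁ pq)
            k₁ = factor D x (proj₂ pq)
            eq = trans (proj₂ k₀) (sym (proj₂ k₁))
        in universal (proj₁ k₀) (proj₁ k₁) eq
         , trans assoc (trans (cong (incl C ∘_) (p₁∘universal eq)) (proj₂ k₀))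
    ; holds = λ k → subst P (sym assoc) (holds C (a₁ ∘ k))
                  , subst Q (trans (sym (commute∘ isPullback k)) (sym assoc)) (holds D (a₂ ∘ k))
    }
    where
      open Pullback (pullback (incl C) (incl D)) using (isPullback) renaming (p₁ to a₁; p₂ to a₂)
      open IsPullback isPullback

  injectivity-locus : ∀ {S B} (g : S ⇒ B) → Comprehension (InjectiveAt g)
  injectivity-locus g =
    Comprehension-resp to from (∀-along c₁ diagonal (section⇒mono c₁ c₁∘diagonal))
    where
      open Pullback (pullback g g) renaming (p₁ to c₁; p₂ to c₂)
      open IsPullback isPullback
      diagonal = universal id id refl
      c₁∘diagonal = p₁∘universal {h = id} {k = id} refl
      c₂∘diagonal = p₂∘universal {h = id} {k = id} refl

      to : ∀ {Z} (y : Z ⇒ _) → (∀ {W} (w : W ⇒ P) (z : W ⇒ Z) → c₁ ∘ w ≡ y ∘ z → Factors w diagonal) →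
           InjectiveAt g y
      to y H y′ z e = begin
        y′                       ≡⟨ sym (p₂∘universal e′) ⟩
        c₂ ∘ w                   ≡⟨ cong (c₂ ∘_) (sym (proj₂ D)) ⟩
        c₂ ∘ (diagonal ∘ proj₁ D) ≡⟨ trans (pullˡ c₂∘diagonal) (sym (pullˡ c₁∘diagonal)) ⟩
        c₁ ∘ (diagonal ∘ proj₁ D) ≡⟨ cong (c₁ ∘_) (proj₂ D) ⟩
        c₁ ∘ w                   ≡⟨ p₁∘universal e′ ⟩
        y ∘ z                    ∎
        where
          e′ = sym e
          w = universal (y ∘ z) y′ e′
          D = H w z (p₁∘universal e′)

      from : ∀ {Z} (y : Z ⇒ _) → InjectiveAt g y →
             ∀ {W} (w : W ⇒ P) (z : W ⇒ Z) → c₁ ∘ w ≡ y ∘ z → Factors w diagonal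
      from y inj w z e = c₁ ∘ w , pullback-jointly-mono isPullback
        (trans (pullˡ c₁∘diagonal) identityˡ)
        (trans (pullˡ c₂∘diagonal) (trans identityˡ (sym c₂w≡c₁w)))
        where
          c₂w≡c₁w = trans (inj (c₂ ∘ w) z (trans (sym (commute∘ isPullback w)) (cong (g ∘_) e)))
                          (sym e)

  section-in-locus : ∀ {A B X} {P : ∀ {Z} → Z ⇒ X → Set (o ⊔ ℓ)} {ma : A ⇒ B} {f : X ⇒ B} {ta : A ⇒ X}
    (C : Comprehension P) → (∀ {Z} (k : Z ⇒ Carrier C) → Agree ma (f ∘ (incl C ∘ k)) ta (incl C ∘ k)) →
    f ∘ ta ≡ ma → Factors ta (incl C) →
    Factors ma ((f ∘ incl C) ∘ incl (injectivity-locus (f ∘ incl C)))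
  section-in-locus {ma = ma} {f} {ta} C agree fta (σ , sσ) =
    proj₁ τ , trans assoc (trans (cong (fs ∘_) (proj₂ τ)) (trans assoc (trans (cong (f ∘_) sσ) fta)))
    where
      s = incl C
      fs = f ∘ s
      over-σ : ∀ {W} (z : W ⇒ _) → ma ∘ z ≡ fs ∘ (σ ∘ z)
      over-σ z = sym (trans (sym assoc) (cong (_∘ z) (trans assoc (trans (cong (f ∘_) sσ) fta))))
      injective : InjectiveAt fs σ
      injective y z e = incl-mono C _ _ (begin
        s ∘ y            ≡⟨ sym identityʳ ⟩
        (s ∘ y) ∘ id     ≡⟨ sym (agree y z id (trans (over-σ z) (trans (sym e) (trans assoc (sym identityʳ))))) ⟩
        ta ∘ z           ≡⟨ cong (_∘ z) (sym sσ) ⟩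
        (s ∘ σ) ∘ z      ≡⟨ assoc ⟩
        s ∘ (σ ∘ z)      ∎)
      τ = factor (injectivity-locus fs) σ injective

  glue : ∀ {A₀ A₁ B X U} {m₀ : A₀ ⇒ B} {m₁ : A₁ ⇒ B} {f : X ⇒ B} {t₀ : A₀ ⇒ X} {t₁ : A₁ ⇒ X} →
    Mono m₀ → Mono m₁ → f ∘ t₀ ≡ m₀ → f ∘ t₁ ≡ m₁ → Agree m₀ m₁ t₀ t₁ →
    (m : U ⇒ B) → IsUnion m₀ m₁ m → Σ (U ⇒ X) (λ t → f ∘ t ≡ m)
  glue {m₀ = m₀} {m₁} {f} {t₀} {t₁} mono₀ mono₁ ft₀ ft₁ agree m union =
    incl C ∘ (incl L ∘ proj₁ k) , trans (sym assoc) (trans (sym assoc) (proj₂ k))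
    where
      C = intersection (agreement-subobject ft₀) (agreement-subobject ft₁)
      L = injectivity-locus (f ∘ incl C)
      t₀∈C = factor C t₀ (subst (λ b → Agree m₀ b t₀ t₀) (sym ft₀) (Agree-refl mono₀)
                        , subst (λ b → Agree m₁ b t₁ t₀) (sym ft₀) (Agree-sym agree))
      t₁∈C = factor C t₁ (subst (λ b → Agree m₀ b t₀ t₁) (sym ft₁) agree
                        , subst (λ b → Agree m₁ b t₁ t₁) (sym ft₁) (Agree-refl mono₁))
      k = IsUnion.least union _ (injectivity-locus-mono L)
            (section-in-locus C (λ j → proj₁ (holds C j)) ft₀ t₀∈C)
            (section-in-locus C (λ j → proj₂ (holds C j)) ft₁ t₁∈C)

mainTheorem12 : ∀ {o ℓ c} (S : Setting o ℓ c) →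
    let open Setting S
        open Fibrations S
    in
    ∀ {A₀ A₁ B X U} (m₀ : A₀ ⇒ B) (m₁ : A₁ ⇒ B) →
    Mono m₀ → Mono m₁ → (Cof m₀ ⊎ Cof m₁) →
    (f : X ⇒ B) → HProp f →
    (t₀ : A₀ ⇒ X) (t₁ : A₁ ⇒ X) → f ∘ t₀ ≡ m₀ → f ∘ t₁ ≡ m₁ →
    (m : U ⇒ B) → IsUnion m₀ m₁ m →
    Σ (U ⇒ X) (λ t → f ∘ t ≡ m)
mainTheorem12 S m₀ m₁ mono₀ mono₁ (inj₁ cof₀) f hp t₀ t₁ ft₀ ft₁ m union =
  let open Construction S
      (t₁′ , ft₁′ , agree) = realign cof₀ hp ft₀ ft₁
  in glue mono₀ mono₁ ft₀ ft₁′ agree m union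
mainTheorem12 S m₀ m₁ mono₀ mono₁ (inj₂ cof₁) f hp t₀ t₁ ft₀ ft₁ m union =
  let open Construction S
      open CategoryFacts (Setting.𝒞 S)
      (t₀′ , ft₀′ , agree) = realign cof₁ hp ft₁ ft₀
  in glue mono₀ mono₁ ft₀′ ft₁ (Agree-sym agree) m union
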